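{- Let $m$ be an even positive integer, $r$ a positive integer, $u$ a complex number with $(u^2+u^{ -2})^2=r$ if $r\ge2$ and $u^4=1$ if $r=1$, $a$ a primitive $2m^2$-th root of unity, and $b$ an $m^2$-th root of unity. Let $H_1,H_2$ be equivalent Hadamard matrices of order $r$. Then $W_{H_1,u,a}$ is equivalent to $W_{H_2,u,a}$, and $W'_{H_1,u,b}$ is equivalent to $W'_{H_2,u,b}$.
   Context: A Hadamard matrix of order $r$ is an $r\times r$ matrix $H$ with entries $\pm1$ and $HH^T=rI$; two Hadamard matrices are equivalent if one can be obtained from the other by negating rows and columns and permuting rows and columns. Let $Y=\{1,\dots,r\}$, $X=\{(i,\ell,x)\mid i,\ell\in\mathbb{Z}_m,x\in Y\}$, $\mathbb{Z}_m$ identified with $\{0,\dots,m-1\}$. $A_u=u^3I-u^{ -1}(J-I)$ ($J$ all-ones). For a Hadamard matrix $H$, $V_{ij}=A_u$ if $i-j$ even, $V_{ij}=H$ if $(i,j)\equiv(0,1)\pmod2$, $V_{ij}=H^T$ if $(i,j)\equiv(1,0)\pmod2$. $W_{H,u,a}((i,\ell,x),(j,\ell',y))=a^{2m(\ell-\ell')(i-j)+(i-j)^2+m(i-j)}V_{ij}(x,y)$; with $\eta$ a fixed primitive $m$-th root of unity, $W'_{H,u,b}((i,\ell,x),(j,\ell',y))=\eta^{(\ell-\ell')(i-j)}b^{(i-j)^2}V_{ij}(x,y)$. Two matrices $W_1,W_2$ indexed by $X$ are equivalent if $cW_1^\sigma=W_2$ for some permutation $\sigma$ of $X$ and some complex $c$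 with $c^4=1$, where $W^\sigma(\alpha,\beta)=W(\sigma(\alpha),\sigma(\beta))$. -}

module Defs where

open import Level using (Level)
open import Data.Nat as ℕ using (ℕ; zero; suc; NonZero; _≥_; _<_)
open import Data.Nat.Properties using (m*n≢0)
open import Data.Integer as ℤ using (ℤ; +_; _%ℕ_; ∣_∣)
open import Data.Fin using (Fin; toℕ; _≟_)
open import Data.Product using (Σ; _×_; _,_)
open import Data.Sum using (_⊎_)
open import Relation.Nullary using (¬_; yes; no)
open import Relation.Binary.PropositionalEquality using (_≡_)
open import Function.Bundles using (_↔_; Inverse)
open import Algebra.Bundles using (CommutativeRing)

Σℤ : (n : ℕ) → (Fin n → ℤ) → ℤ
Σℤ zero    f = + 0
Σℤ (suc n) f = f Fin.zero ℤ.+ Σℤ n (λ i → f (Fin.suc i))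

IsSign : ℤ → Set
IsSign z = (z ≡ + 1) ⊎ (z ≡ ℤ.- (+ 1))

δ : {n : ℕ} → Fin n → Fin n → ℕ → ℤ
δ i k r with i ≟ k
... | yes _ = + r
... | no  _ = + 0

IsHadamard : (r : ℕ) → (Fin r → Fin r → ℤ) → Set
IsHadamard r H =
  (∀ i j → IsSign (H i j)) ×
  (∀ i k → Σℤ r (λ j → H i j ℤ.* H k j) ≡ δ i k r)

HadEquiv : (r : ℕ) → (Fin r → Fin r → ℤ) → (Fin r → Fin r → ℤ) → Set
HadEquiv r H₁ H₂ =
  Σ (Fin r ↔ Fin r) λ π → Σ (Fin r ↔ Fin r) λ ρ →
  Σ (Fin r → ℤ) λ d → Σ (Fin r → ℤ) λ e →
  (∀ i → IsSign (d i)) × (∀ j → IsSign (e j)) ×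
  (∀ i j → H₂ i j ≡ d i ℤ.* e j ℤ.* H₁ (Inverse.to π i) (Inverse.to ρ j))

module _ {c ℓ : Level} (F : CommutativeRing c ℓ) where
  open CommutativeRing F

  IsField : Set (c Level.⊔ ℓ)
  IsField = (¬ (0# ≈ 1#)) × (∀ x → ¬ (x ≈ 0#) → Σ Carrier λ y → x * y ≈ 1#)

  pow : Carrier → ℕ → Carrier
  pow x zero    = 1#
  pow x (suc n) = x * pow x n

  fromℕ : ℕ → Carrier
  fromℕ zero    = 0#
  fromℕ (suc n) = 1# + fromℕ n

  fromℤ : ℤ → Carrier
  fromℤ (+ n)      = fromℕ n
  fromℤ ℤ.-[1+ n ] = - fromℕ (suc n)

  IsRootOfUnity : ℕ → Carrier → Set ℓ
  IsRootOfUnity N x = pow x N ≈ 1#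

  IsPrimitiveRoot : ℕ → Carrier → Set ℓ
  IsPrimitiveRoot N x = pow x N ≈ 1# × (∀ k → 0 < k → k < N → ¬ (pow x k ≈ 1#))

  -- integer power x^e of an N-th root of unity x (N > 0), computed as x^(e mod N)
  rpow : Carrier → (N : ℕ) → .{{NonZero N}} → ℤ → Carrier
  rpow x N e = pow x (e %ℕ N)

  -- A_u = u³ I − u⁻¹ (J − I), with uinv the inverse of u
  Au : (r : ℕ) → Carrier → Carrier → Fin r → Fin r → Carrier
  Au r u uinv x y with x ≟ y
  ... | yes _ = pow u 3
  ... | no  _ = - uinv

  V : (m r : ℕ) → (Fin r → Fin r → ℤ) → Carrier → Carrier →
      Fin m → Fin m → Fin r → Fin r → Carrier
  V m r H u uinv i j x y with toℕ i ℕ.% 2 | toℕ j ℕ.% 2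
  ... | 0 | 0 = Au r u uinv x y
  ... | 1 | 1 = Au r u uinv x y
  ... | 0 | _ = fromℤ (H x y)
  ... | _ | _ = fromℤ (H y x)

  X : ℕ → ℕ → Set
  X m r = Fin m × Fin m × Fin r

  -- difference of elements of ℤ_m identified with {0,…,m−1}, as an integer
  dif : {m : ℕ} → Fin m → Fin m → ℤ
  dif i j = + toℕ i ℤ.- + toℕ j

  W : (m r : ℕ) → .{{NonZero m}} → (Fin r → Fin r → ℤ) → (u uinv a : Carrier) →
      X m r → X m r → Carrier
  W m r H u uinv a (i , l , x) (j , l' , y) =
    rpow a (2 ℕ.* m ℕ.* m) {{m*n≢0 (2 ℕ.* m) m {{m*n≢0 2 m}}}}
      ((+ (2 ℕ.* m)) ℤ.* dif l l' ℤ.* dif i j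
        ℤ.+ dif i j ℤ.* dif i j
        ℤ.+ (+ m) ℤ.* dif i j)
    * V m r H u uinv i j x y

  -- W'_{H,u,b} (with η the fixed primitive m-th root of unity)
  W' : (m r : ℕ) → .{{NonZero m}} → (Fin r → Fin r → ℤ) → (u uinv η b : Carrier) →
       X m r → X m r → Carrier
  W' m r H u uinv η b (i , l , x) (j , l' , y) =
    rpow η m (dif l l' ℤ.* dif i j)
    * pow b (∣ dif i j ∣ ℕ.* ∣ dif i j ∣)
    * V m r H u uinv i j x y

  MatEquiv : (m r : ℕ) → (X m r → X m r → Carrier) → (X m r → X m r → Carrier) →
             Set (c Level.⊔ ℓ)
  MatEquiv m r W₁ W₂ =
    Σ (X m r ↔ X m r) λ σ → Σ Carrier λ c₀ →
      (pow c₀ 4 ≈ 1#) ×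
      (∀ α β → c₀ * W₁ (Inverse.to σ α) (Inverse.to σ β) ≈ W₂ α β)

-- Write h = m/2 and H₂ = D · (H₁ with rows permuted by π, columns by ρ) · E for sign matrices D, E.
-- Moving an index (i, ℓ, x) to (i, ℓ + h, x) multiplies the scalar in front of V_{ij} in W and in W′
-- by (−1)^(i−j), since a^(2m·h) = a^(m²) = −1 and η^h = −1. As i − j is odd exactly on the blocks
-- H, Hᵀ and even on the blocks A_u, doing this at the indices with i even and D_x = −1, or i odd and
-- E_x = −1, reproduces the signs D and E and leaves A_u alone. Applying π to x in even block rows and
-- ρ in odd ones accounts for the permutations, A_u being invariant under them. So W_{H₂} = W_{H₁}^σ
-- with c = 1.
module Submission where

open import Defs
open import Level using (Level)
open import Algebra.Bundles using (CommutativeRing)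
open import Data.Bool using (Bool; true; false)
open import Data.Empty using (⊥-elim)
open import Data.Fin using (Fin; toℕ; fromℕ<; _≟_)
import Data.Fin.Properties as Finₚ
open import Data.Integer as ℤ using (ℤ; +_; -[1+_])
import Data.Integer.Properties as ℤₚ
open import Data.Integer.DivMod using (a≡a%ℕn+[a/ℕn]*n)
open import Data.Integer.Tactic.RingSolver using (solve-∀)
open import Data.Nat as ℕ using (ℕ; zero; suc; NonZero; _≥_; _<_; s≤s)
import Data.Nat.Properties as ℕₚ
open import Data.Nat.DivMod using (m≡m%n+[m/n]*n; m%n<n; m%n%n≡m%n; %-distribˡ-+; [m+n]%n≡m%n; m<n⇒m%n≡m)
open import Data.Nat.Divisibility using (_∣_; divides)
import Data.Nat.Tactic.RingSolver as ℕ-Solver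
open import Data.Product using (Σ; _×_; _,_; proj₁; proj₂)
open import Data.Sum using (inj₁; inj₂)
open import Function.Definitions using (Injective)
open import Function.Bundles using (_↔_; Inverse; Injection; mk↔ₛ′)
open import Function.Properties.Inverse using (↔⇒↣)
open import Relation.Nullary using (¬_; yes; no)
open import Relation.Binary.PropositionalEquality as ≡ using (_≡_)

bit : Bool → ℤ
bit false = + 0
bit true  = + 1

signℤ : Bool → ℤ
signℤ false = + 1
signℤ true  = ℤ.- + 1

isNegative : ∀ z → IsSign z → Bool
isNegative _ (inj₁ _) = false
isNegative _ (inj₂ _) = true

IsSign⇒≡signℤ : ∀ z (s : IsSign z) → z ≡ signℤ (isNegative z s)
IsSign⇒≡signℤ _ (inj₁ eq) = eq
IsSign⇒≡signℤ _ (inj₂ eq) = eq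

-- Indexed by n % 2 so that matching on it also unfolds V, which is defined by cases on toℕ i % 2.
data Parity (n : ℕ) : ℕ → Set where
  even : ∀ a → + n ≡ + 0 ℤ.+ + 2 ℤ.* a → Parity n 0
  odd  : ∀ a → + n ≡ + 1 ℤ.+ + 2 ℤ.* a → Parity n 1

parity : ∀ n → Parity n (n ℕ.% 2)
parity n = classify (n ℕ.% 2) (m%n<n n 2) (≡.cong +_ (m≡m%n+[m/n]*n n 2))
  where
  half : ℤ
  half = + (n ℕ./ 2)
  twice : + (n ℕ./ 2 ℕ.* 2) ≡ + 2 ℤ.* half
  twice = ≡.trans (ℤₚ.pos-* (n ℕ./ 2) 2) (ℤₚ.*-comm half (+ 2))
  classify : ∀ p → p < 2 → + n ≡ + (p ℕ.+ n ℕ./ 2 ℕ.* 2) → Parity n p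
  classify 0 _ eq = even half (≡.trans eq (≡.trans twice (≡.sym (ℤₚ.+-identityˡ _))))
  classify 1 _ eq = odd half (≡.trans eq (≡.cong (λ z → + 1 ℤ.+ z) twice))
  classify (suc (suc _)) (s≤s (s≤s ())) _

[[n+h]%m+h]%m≡n : ∀ {m h n} .{{_ : NonZero m}} → h ℕ.+ h ≡ m → n < m →
                  ((n ℕ.+ h) ℕ.% m ℕ.+ h) ℕ.% m ≡ n
[[n+h]%m+h]%m≡n {m} {h} {n} h+h≡m n<m = begin
  ((n ℕ.+ h) ℕ.% m ℕ.+ h) ℕ.% m                ≡⟨ %-distribˡ-+ ((n ℕ.+ h) ℕ.% m) h m ⟩
  ((n ℕ.+ h) ℕ.% m ℕ.% m ℕ.+ h ℕ.% m) ℕ.% m   ≡⟨ ≡.cong (λ k → (k ℕ.+ h ℕ.% m) ℕ.% m)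
                                                        (m%n%n≡m%n (n ℕ.+ h) m) ⟩
  ((n ℕ.+ h) ℕ.% m ℕ.+ h ℕ.% m) ℕ.% m          ≡⟨ %-distribˡ-+ (n ℕ.+ h) h m ⟨
  (n ℕ.+ h ℕ.+ h) ℕ.% m                         ≡⟨ ≡.cong (ℕ._% m)
                                                     (≡.trans (ℕₚ.+-assoc n h h) (≡.cong (n ℕ.+_) h+h≡m)) ⟩
  (n ℕ.+ m) ℕ.% m                               ≡⟨ [m+n]%n≡m%n n m ⟩
  n ℕ.% m                                       ≡⟨ m<n⇒m%n≡m n<m ⟩
  n                                             ∎
  where open ≡.≡-Reasoning

≡-shift-difference : ∀ {z r n} q k d → z ≡ r ℤ.+ q ℤ.* d → z ≡ n ℤ.+ k ℤ.* d →
                     r ≡ n ℤ.+ (k ℤ.- q) ℤ.* d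
≡-shift-difference {r = r} {n} q k d ≡.refl eq = begin
  r                                ≡⟨ cancel r q d ⟩
  (r ℤ.+ q ℤ.* d) ℤ.- q ℤ.* d      ≡⟨ ≡.cong (ℤ._- q ℤ.* d) eq ⟩
  (n ℤ.+ k ℤ.* d) ℤ.- q ℤ.* d      ≡⟨ regroup n k q d ⟩
  n ℤ.+ (k ℤ.- q) ℤ.* d            ∎
  where
  open ≡.≡-Reasoning
  cancel : ∀ r q d → r ≡ (r ℤ.+ q ℤ.* d) ℤ.- q ℤ.* d
  cancel = solve-∀
  regroup : ∀ n k q d → (n ℤ.+ k ℤ.* d) ℤ.- q ℤ.* d ≡ n ℤ.+ (k ℤ.- q) ℤ.* d
  regroup = solve-∀

%-as-shift : ∀ n d .{{_ : NonZero d}} → Σ ℤ λ k → + (n ℕ.% d) ≡ + n ℤ.+ k ℤ.* + d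
%-as-shift n d = + 0 ℤ.- q , ≡-shift-difference {n = + n} q (+ 0) (+ d) n≡r+qd (pad (+ n) (+ d))
  where
  q : ℤ
  q = + (n ℕ./ d)
  n≡r+qd : + n ≡ + (n ℕ.% d) ℤ.+ q ℤ.* + d
  n≡r+qd = ≡.trans (≡.cong +_ (m≡m%n+[m/n]*n n d)) (≡.cong (λ z → + (n ℕ.% d) ℤ.+ z) (ℤₚ.pos-* (n ℕ./ d) d))
  pad : ∀ n d → n ≡ n ℤ.+ + 0 ℤ.* d
  pad = solve-∀

m*m+m*m≡2*m*m : ∀ m → m ℕ.* m ℕ.+ m ℕ.* m ≡ 2 ℕ.* m ℕ.* m
m*m+m*m≡2*m*m = ℕ-Solver.solve-∀

n+n≡m⇒0<n : ∀ {m n} .{{_ : NonZero m}} → n ℕ.+ n ≡ m → 0 < n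
n+n≡m⇒0<n {m} {zero}  0≡m = ⊥-elim (ℕ.≢-nonZero⁻¹ m (≡.sym 0≡m))
n+n≡m⇒0<n {n = suc _} _   = s≤s ℕ.z≤n

same-parity-exponent : ∀ {I J} p a b x y → I ≡ p ℤ.+ + 2 ℤ.* a → J ≡ p ℤ.+ + 2 ℤ.* b →
                       Σ ℤ λ t → (x ℤ.- y) ℤ.* (I ℤ.- J) ≡ t ℤ.* + 2
same-parity-exponent p a b x y ≡.refl ≡.refl = (x ℤ.- y) ℤ.* (a ℤ.- b) , identity p a b x y
  where
  identity : ∀ p a b x y → (x ℤ.- y) ℤ.* ((p ℤ.+ + 2 ℤ.* a) ℤ.- (p ℤ.+ + 2 ℤ.* b)) ≡
                           ((x ℤ.- y) ℤ.* (a ℤ.- b)) ℤ.* + 2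
  identity = solve-∀

even-odd-exponent : ∀ {I J} a b x y → I ≡ + 0 ℤ.+ + 2 ℤ.* a → J ≡ + 1 ℤ.+ + 2 ℤ.* b →
                    Σ ℤ λ t → (x ℤ.- y) ℤ.* (I ℤ.- J) ≡ x ℤ.+ y ℤ.+ t ℤ.* + 2
even-odd-exponent a b x y ≡.refl ≡.refl = (x ℤ.- y) ℤ.* (a ℤ.- b) ℤ.- x , identity a b x y
  where
  identity : ∀ a b x y → (x ℤ.- y) ℤ.* ((+ 0 ℤ.+ + 2 ℤ.* a) ℤ.- (+ 1 ℤ.+ + 2 ℤ.* b)) ≡
                         x ℤ.+ y ℤ.+ ((x ℤ.- y) ℤ.* (a ℤ.- b) ℤ.- x) ℤ.* + 2
  identity = solve-∀

odd-even-exponent : ∀ {I J} a b x y → I ≡ + 1 ℤ.+ + 2 ℤ.* a → J ≡ + 0 ℤ.+ + 2 ℤ.* b →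
                    Σ ℤ λ t → (x ℤ.- y) ℤ.* (I ℤ.- J) ≡ y ℤ.+ x ℤ.+ t ℤ.* + 2
odd-even-exponent a b x y ≡.refl ≡.refl = (x ℤ.- y) ℤ.* (a ℤ.- b) ℤ.- y , identity a b x y
  where
  identity : ∀ a b x y → (x ℤ.- y) ℤ.* ((+ 1 ℤ.+ + 2 ℤ.* a) ℤ.- (+ 0 ℤ.+ + 2 ℤ.* b)) ≡
                         y ℤ.+ x ℤ.+ ((x ℤ.- y) ℤ.* (a ℤ.- b) ℤ.- y) ℤ.* + 2
  identity = solve-∀

onParity : {A : Set} → ℕ → A → A → A
onParity zero    a b = a
onParity (suc _) a b = b

onParity-inverse : ∀ {A : Set} n {f g f′ g′ : A → A} → (∀ x → f (f′ x) ≡ x) → (∀ x → g (g′ x) ≡ x) →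
                   ∀ x → onParity n f g (onParity n f′ g′ x) ≡ x
onParity-inverse zero    f∘f′ _ = f∘f′
onParity-inverse (suc _) _ g∘g′ = g∘g′

module Exponentiation {c ℓ : Level} (F : CommutativeRing c ℓ) where
  open CommutativeRing F
  open import Algebra.Properties.Ring ring using (-1*x≈-x; -‿involutive; x[y-z]≈xy-xz; -0#≈0#)
  open import Algebra.Properties.AbelianGroup +-abelianGroup using () renaming
    (inverseˡ-unique to +-inverseˡ-unique; x∙y⁻¹≈ε⇒x≈y to x-y≈0⇒x≈y)
  open import Relation.Binary.Reasoning.Setoid setoid

  pow-cong : ∀ {x y} n → x ≈ y → pow F x n ≈ pow F y n
  pow-cong zero    _   = refl
  pow-cong (suc n) x≈y = *-cong x≈y (pow-cong n x≈y)

  pow-+ : ∀ x p q → pow F x (p ℕ.+ q) ≈ pow F x p * pow F x q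
  pow-+ x zero    q = sym (*-identityˡ _)
  pow-+ x (suc p) q = trans (*-congˡ (pow-+ x p q)) (sym (*-assoc _ _ _))

  pow-* : ∀ x p q → pow F x (p ℕ.* q) ≈ pow F (pow F x p) q
  pow-* x p zero    = reflexive (≡.cong (pow F x) (ℕₚ.*-zeroʳ p))
  pow-* x p (suc q) = begin
    pow F x (p ℕ.* suc q)                ≡⟨ ≡.cong (pow F x) (ℕₚ.*-suc p q) ⟩
    pow F x (p ℕ.+ p ℕ.* q)              ≈⟨ pow-+ x p (p ℕ.* q) ⟩
    pow F x p * pow F x (p ℕ.* q)        ≈⟨ *-congˡ (pow-* x p q) ⟩
    pow F x p * pow F (pow F x p) q      ∎

  pow-1# : ∀ n → pow F 1# n ≈ 1#
  pow-1# zero    = refl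
  pow-1# (suc n) = trans (*-congˡ (pow-1# n)) (*-identityˡ 1#)

  -1*-1≈1 : - 1# * - 1# ≈ 1#
  -1*-1≈1 = trans (-1*x≈-x _) (-‿involutive _)

  fromℤ-neg : ∀ z → fromℤ F (ℤ.- z) ≈ - fromℤ F z
  fromℤ-neg (+ zero)  = sym -0#≈0#
  fromℤ-neg (+ suc n) = refl
  fromℤ-neg -[1+ n ]  = sym (-‿involutive _)

  module RootOfUnity (ζ : Carrier) (N : ℕ) .{{_ : NonZero N}} (ζ^N≈1 : pow F ζ N ≈ 1#) where

    pow-multiple : ∀ k → pow F ζ (k ℕ.* N) ≈ 1#
    pow-multiple zero    = refl
    pow-multiple (suc k) = trans (pow-+ ζ N (k ℕ.* N)) (trans (*-cong ζ^N≈1 (pow-multiple k)) (*-identityˡ 1#))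

    pow-≡-mod : ∀ p q k → + p ≡ + q ℤ.+ k ℤ.* + N → pow F ζ p ≈ pow F ζ q
    pow-≡-mod p q (+ k) eq = begin
      pow F ζ p                         ≡⟨ ≡.cong (pow F ζ) p≡q+kN ⟩
      pow F ζ (q ℕ.+ k ℕ.* N)           ≈⟨ pow-+ ζ q (k ℕ.* N) ⟩
      pow F ζ q * pow F ζ (k ℕ.* N)     ≈⟨ *-congˡ (pow-multiple k) ⟩
      pow F ζ q * 1#                    ≈⟨ *-identityʳ _ ⟩
      pow F ζ q                         ∎
      where
      p≡q+kN : p ≡ q ℕ.+ k ℕ.* N
      p≡q+kN = ℤₚ.+-injective (≡.trans eq (≡.cong (λ z → + q ℤ.+ z) (≡.sym (ℤₚ.pos-* k N))))
    pow-≡-mod p q -[1+ k ] eq = sym (pow-≡-mod q p (+ suc k) q≡p+[1+k]N)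
      where
      flip : ∀ q k n → q ≡ (q ℤ.+ k ℤ.* n) ℤ.+ ℤ.- k ℤ.* n
      flip = solve-∀
      q≡p+[1+k]N : + q ≡ + p ℤ.+ + suc k ℤ.* + N
      q≡p+[1+k]N = ≡.trans (flip (+ q) -[1+ k ] (+ N)) (≡.cong (λ z → z ℤ.+ ℤ.- -[1+ k ] ℤ.* + N) (≡.sym eq))

    rpow≈pow : ∀ z n k → z ≡ + n ℤ.+ k ℤ.* + N → rpow F ζ N z ≈ pow F ζ n
    rpow≈pow z n k eq =
      pow-≡-mod (z ℤ.%ℕ N) n (k ℤ.- z ℤ./ℕ N)
        (≡-shift-difference {n = + n} (z ℤ./ℕ N) k (+ N) (a≡a%ℕn+[a/ℕn]*n z N) eq)

    rpow-pos : ∀ n → rpow F ζ N (+ n) ≈ pow F ζ n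
    rpow-pos n = rpow≈pow (+ n) n (+ 0) (pad (+ n) (+ N))
      where
      pad : ∀ n d → n ≡ n ℤ.+ + 0 ℤ.* d
      pad = solve-∀

    rpow-+ : ∀ x y → rpow F ζ N (x ℤ.+ y) ≈ rpow F ζ N x * rpow F ζ N y
    rpow-+ x y = trans (rpow≈pow (x ℤ.+ y) (x ℤ.%ℕ N ℕ.+ y ℤ.%ℕ N) (x ℤ./ℕ N ℤ.+ y ℤ./ℕ N) eq)
                       (pow-+ ζ (x ℤ.%ℕ N) (y ℤ.%ℕ N))
      where
      regroup : ∀ r s q p n → (r ℤ.+ q ℤ.* n) ℤ.+ (s ℤ.+ p ℤ.* n) ≡ (r ℤ.+ s) ℤ.+ (q ℤ.+ p) ℤ.* n
      regroup = solve-∀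
      eq : x ℤ.+ y ≡ + (x ℤ.%ℕ N ℕ.+ y ℤ.%ℕ N) ℤ.+ (x ℤ./ℕ N ℤ.+ y ℤ./ℕ N) ℤ.* + N
      eq = ≡.trans (≡.cong₂ ℤ._+_ (a≡a%ℕn+[a/ℕn]*n x N) (a≡a%ℕn+[a/ℕn]*n y N))
                   (regroup (+ (x ℤ.%ℕ N)) (+ (y ℤ.%ℕ N)) (x ℤ./ℕ N) (y ℤ./ℕ N) (+ N))

    rpow-periodic : ∀ z t → rpow F ζ N (z ℤ.+ t ℤ.* + N) ≈ rpow F ζ N z
    rpow-periodic z t = rpow≈pow (z ℤ.+ t ℤ.* + N) (z ℤ.%ℕ N) (z ℤ./ℕ N ℤ.+ t)
      (≡.trans (≡.cong (ℤ._+ t ℤ.* + N) (a≡a%ℕn+[a/ℕn]*n z N)) (regroup (+ (z ℤ.%ℕ N)) (z ℤ./ℕ N) t (+ N)))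
      where
      regroup : ∀ r q t n → (r ℤ.+ q ℤ.* n) ℤ.+ t ℤ.* n ≡ r ℤ.+ (q ℤ.+ t) ℤ.* n
      regroup = solve-∀

  -1^_ : ℤ → Carrier
  -1^ z = rpow F (- 1#) 2 z

  private
    module Sign = RootOfUnity (- 1#) 2 (trans (*-congˡ (*-identityʳ _)) -1*-1≈1)

  -1^-even : ∀ {E} → Σ ℤ (λ t → E ≡ t ℤ.* + 2) → -1^ E ≈ 1#
  -1^-even {E} (t , eq) = Sign.rpow≈pow E 0 t (≡.trans eq (≡.sym (ℤₚ.+-identityˡ _)))

  -1^-odd : ∀ {E} x y → Σ ℤ (λ t → E ≡ x ℤ.+ y ℤ.+ t ℤ.* + 2) → -1^ E ≈ -1^ x * -1^ y
  -1^-odd x y (t , ≡.refl) = trans (Sign.rpow-periodic (x ℤ.+ y) t) (Sign.rpow-+ x y)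

  fromℤ-signℤ : ∀ p z → fromℤ F (signℤ p ℤ.* z) ≈ -1^ bit p * fromℤ F z
  fromℤ-signℤ false z = begin
    fromℤ F (+ 1 ℤ.* z)      ≡⟨ ≡.cong (fromℤ F) (ℤₚ.*-identityˡ z) ⟩
    fromℤ F z                ≈⟨ *-identityˡ _ ⟨
    1# * fromℤ F z           ∎
  fromℤ-signℤ true z = begin
    fromℤ F (ℤ.- + 1 ℤ.* z)  ≡⟨ ≡.cong (fromℤ F) (ℤₚ.-1*i≡-i z) ⟩
    fromℤ F (ℤ.- z)          ≈⟨ fromℤ-neg z ⟩
    - fromℤ F z              ≈⟨ -1*x≈-x _ ⟨
    - 1# * fromℤ F z         ≈⟨ *-congʳ (*-identityʳ _) ⟨
    (- 1# * 1#) * fromℤ F z  ∎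

  module HalfPeriod (ζ : Carrier) (N K : ℕ) .{{_ : NonZero N}} (K+K≡N : K ℕ.+ K ≡ N)
                    (ζ^K≈-1 : pow F ζ K ≈ - 1#) where

    ζ^N≈1 : pow F ζ N ≈ 1#
    ζ^N≈1 = begin
      pow F ζ N               ≡⟨ ≡.cong (pow F ζ) K+K≡N ⟨
      pow F ζ (K ℕ.+ K)       ≈⟨ pow-+ ζ K K ⟩
      pow F ζ K * pow F ζ K   ≈⟨ *-cong ζ^K≈-1 ζ^K≈-1 ⟩
      - 1# * - 1#             ≈⟨ -1*-1≈1 ⟩
      1#                      ∎

    open RootOfUnity ζ N ζ^N≈1

    rpow-half-shift : ∀ {E} z c → Σ ℤ (λ t → E ≡ z ℤ.+ + K ℤ.* c ℤ.+ t ℤ.* + N) →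
                      rpow F ζ N E ≈ rpow F ζ N z * -1^ c
    rpow-half-shift {E} z c (t , E≡) = begin
      rpow F ζ N E                                        ≡⟨ ≡.cong (rpow F ζ N) E≡z+Kr+[t+q]N ⟩
      rpow F ζ N (z ℤ.+ + (K ℕ.* r) ℤ.+ (t ℤ.+ q) ℤ.* + N)  ≈⟨ rpow-periodic (z ℤ.+ + (K ℕ.* r)) (t ℤ.+ q) ⟩
      rpow F ζ N (z ℤ.+ + (K ℕ.* r))                      ≈⟨ rpow-+ z (+ (K ℕ.* r)) ⟩
      rpow F ζ N z * rpow F ζ N (+ (K ℕ.* r))             ≈⟨ *-congˡ (rpow-pos (K ℕ.* r)) ⟩
      rpow F ζ N z * pow F ζ (K ℕ.* r)                    ≈⟨ *-congˡ (pow-* ζ K r) ⟩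
      rpow F ζ N z * pow F (pow F ζ K) r                  ≈⟨ *-congˡ (pow-cong r ζ^K≈-1) ⟩
      rpow F ζ N z * -1^ c                                ∎
      where
      r : ℕ
      r = c ℤ.%ℕ 2
      q : ℤ
      q = c ℤ./ℕ 2
      regroup : ∀ {c n Kr} z k r q t → c ≡ r ℤ.+ q ℤ.* + 2 → n ≡ k ℤ.+ k → Kr ≡ k ℤ.* r →
                z ℤ.+ k ℤ.* c ℤ.+ t ℤ.* n ≡ (z ℤ.+ Kr) ℤ.+ (t ℤ.+ q) ℤ.* n
      regroup z k r q t ≡.refl ≡.refl ≡.refl = identity z k r q t
        where
        identity : ∀ z k r q t → z ℤ.+ k ℤ.* (r ℤ.+ q ℤ.* + 2) ℤ.+ t ℤ.* (k ℤ.+ k) ≡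
                                 (z ℤ.+ k ℤ.* r) ℤ.+ (t ℤ.+ q) ℤ.* (k ℤ.+ k)
        identity = solve-∀
      E≡z+Kr+[t+q]N : E ≡ z ℤ.+ + (K ℕ.* r) ℤ.+ (t ℤ.+ q) ℤ.* + N
      E≡z+Kr+[t+q]N = ≡.trans E≡
        (regroup z (+ K) (+ r) q t (a≡a%ℕn+[a/ℕn]*n c 2) (≡.cong +_ (≡.sym K+K≡N)) (ℤₚ.pos-* K r))

  module _ (isField : IsField F) where

    square≈1⇒≈-1 : ∀ x → x * x ≈ 1# → ¬ (x ≈ 1#) → x ≈ - 1#
    square≈1⇒≈-1 x x²≈1 x≉1 = +-inverseˡ-unique x 1# x+1≈0
      where
      x-1≉0 : ¬ (x - 1# ≈ 0#)
      x-1≉0 eq = x≉1 (x-y≈0⇒x≈y x 1# eq)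
      y : Carrier
      y = proj₁ (proj₂ isField (x - 1#) x-1≉0)
      [x-1]y≈1 : (x - 1#) * y ≈ 1#
      [x-1]y≈1 = proj₂ (proj₂ isField (x - 1#) x-1≉0)
      [x+1][x-1]≈0 : (x + 1#) * (x - 1#) ≈ 0#
      [x+1][x-1]≈0 = begin
        (x + 1#) * (x - 1#)                  ≈⟨ x[y-z]≈xy-xz (x + 1#) x 1# ⟩
        (x + 1#) * x - (x + 1#) * 1#         ≈⟨ +-cong (distribʳ x x 1#) (-‿cong (*-identityʳ _)) ⟩
        (x * x + 1# * x) - (x + 1#)          ≈⟨ +-congʳ (+-cong x²≈1 (*-identityˡ x)) ⟩
        (1# + x) - (x + 1#)                  ≈⟨ +-congʳ (+-comm 1# x) ⟩
        (x + 1#) - (x + 1#)                  ≈⟨ -‿inverseʳ _ ⟩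
        0#                                   ∎
      x+1≈0 : x + 1# ≈ 0#
      x+1≈0 = begin
        x + 1#                               ≈⟨ *-identityʳ _ ⟨
        (x + 1#) * 1#                        ≈⟨ *-congˡ [x-1]y≈1 ⟨
        (x + 1#) * ((x - 1#) * y)            ≈⟨ *-assoc _ _ _ ⟨
        ((x + 1#) * (x - 1#)) * y            ≈⟨ *-congʳ [x+1][x-1]≈0 ⟩
        0# * y                               ≈⟨ zeroˡ y ⟩
        0#                                   ∎

    primitive-root^half≈-1 : ∀ {ζ N} K → IsPrimitiveRoot F N ζ → K ℕ.+ K ≡ N → 0 < K → pow F ζ K ≈ - 1#
    primitive-root^half≈-1 {ζ} {N} K (ζ^N≈1 , minimal) K+K≡N 0<K = square≈1⇒≈-1 (pow F ζ K)
      (trans (sym (pow-+ ζ K K)) (trans (reflexive (≡.cong (pow F ζ) K+K≡N)) ζ^N≈1))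
      (minimal K 0<K (≡.subst (K <_) K+K≡N (ℕₚ.m<m+n K 0<K)))

module HalfShift (m h : ℕ) .{{_ : NonZero m}} (h+h≡m : h ℕ.+ h ≡ m) where

  shift : Fin m → Fin m
  shift l = fromℕ< (m%n<n (toℕ l ℕ.+ h) m)

  toℕ-shift : ∀ l → toℕ (shift l) ≡ (toℕ l ℕ.+ h) ℕ.% m
  toℕ-shift l = Finₚ.toℕ-fromℕ< (m%n<n (toℕ l ℕ.+ h) m)

  shift-involutive : ∀ l → shift (shift l) ≡ l
  shift-involutive l = Finₚ.toℕ-injective (≡.trans (toℕ-shift (shift l))
    (≡.trans (≡.cong (λ n → (n ℕ.+ h) ℕ.% m) (toℕ-shift l)) ([[n+h]%m+h]%m≡n h+h≡m (Finₚ.toℕ<n l))))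

  shiftIf : Bool → Fin m → Fin m
  shiftIf false l = l
  shiftIf true  l = shift l

  shiftIf-involutive : ∀ b l → shiftIf b (shiftIf b l) ≡ l
  shiftIf-involutive false l = ≡.refl
  shiftIf-involutive true  l = shift-involutive l

  toℤ-shiftIf : ∀ b l → Σ ℤ λ k → + toℕ (shiftIf b l) ≡ + toℕ l ℤ.+ + h ℤ.* bit b ℤ.+ k ℤ.* + m
  toℤ-shiftIf false l = + 0 , pad (+ toℕ l) (+ h) (+ m)
    where
    pad : ∀ l h m → l ≡ l ℤ.+ h ℤ.* + 0 ℤ.+ + 0 ℤ.* m
    pad = solve-∀
  toℤ-shiftIf true l with %-as-shift (toℕ l ℕ.+ h) m
  ... | k , eq = k , ≡.trans (≡.cong +_ (toℕ-shift l))
    (≡.trans eq (≡.cong (λ z → + toℕ l ℤ.+ z ℤ.+ k ℤ.* + m) (≡.sym (ℤₚ.*-identityʳ (+ h)))))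

  exponentW exponentW′ : ℤ → ℤ → ℤ → ℤ
  exponentW  L L′ D = + (2 ℕ.* m) ℤ.* (L ℤ.- L′) ℤ.* D ℤ.+ D ℤ.* D ℤ.+ + m ℤ.* D
  exponentW′ L L′ D = (L ℤ.- L′) ℤ.* D

  exponentW-shift : ∀ b b′ l l′ D → Σ ℤ λ t →
    exponentW (+ toℕ (shiftIf b l)) (+ toℕ (shiftIf b′ l′)) D ≡
    exponentW (+ toℕ l) (+ toℕ l′) D ℤ.+ + (m ℕ.* m) ℤ.* ((bit b ℤ.- bit b′) ℤ.* D)
      ℤ.+ t ℤ.* + (2 ℕ.* m ℕ.* m)
  exponentW-shift b b′ l l′ D with toℤ-shiftIf b l | toℤ-shiftIf b′ l′
  ... | k , l₁≡ | k′ , l₁′≡ = (k ℤ.- k′) ℤ.* D ,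
    shifted {M = + m} {+ h} {+ toℕ l} {+ toℕ l′} {x = bit b} {bit b′} {k} {k′}
      (ℤₚ.pos-* 2 m) (ℤₚ.pos-* m m) (ℤₚ.pos-* (2 ℕ.* m) m) (≡.cong +_ (≡.sym h+h≡m)) l₁≡ l₁′≡
    where
    shifted : ∀ {A K N M H L L′ L₁ L₁′ x y cx cy : ℤ} →
      A ≡ + 2 ℤ.* M → K ≡ M ℤ.* M → N ≡ A ℤ.* M → M ≡ H ℤ.+ H →
      L₁ ≡ L ℤ.+ H ℤ.* x ℤ.+ cx ℤ.* M → L₁′ ≡ L′ ℤ.+ H ℤ.* y ℤ.+ cy ℤ.* M →
      A ℤ.* (L₁ ℤ.- L₁′) ℤ.* D ℤ.+ D ℤ.* D ℤ.+ M ℤ.* D ≡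
      (A ℤ.* (L ℤ.- L′) ℤ.* D ℤ.+ D ℤ.* D ℤ.+ M ℤ.* D)
        ℤ.+ K ℤ.* ((x ℤ.- y) ℤ.* D) ℤ.+ ((cx ℤ.- cy) ℤ.* D) ℤ.* N
    shifted {H = H} {L} {L′} {x = x} {y} {cx} {cy} ≡.refl ≡.refl ≡.refl ≡.refl ≡.refl ≡.refl =
      identity H L L′ x y cx cy D
      where
      identity : ∀ H L L′ x y cx cy D →
        (+ 2 ℤ.* (H ℤ.+ H))
          ℤ.* ((L ℤ.+ H ℤ.* x ℤ.+ cx ℤ.* (H ℤ.+ H)) ℤ.- (L′ ℤ.+ H ℤ.* y ℤ.+ cy ℤ.* (H ℤ.+ H))) ℤ.* D
          ℤ.+ D ℤ.* D ℤ.+ (H ℤ.+ H) ℤ.* D ≡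
        ((+ 2 ℤ.* (H ℤ.+ H)) ℤ.* (L ℤ.- L′) ℤ.* D ℤ.+ D ℤ.* D ℤ.+ (H ℤ.+ H) ℤ.* D)
          ℤ.+ ((H ℤ.+ H) ℤ.* (H ℤ.+ H)) ℤ.* ((x ℤ.- y) ℤ.* D)
          ℤ.+ ((cx ℤ.- cy) ℤ.* D) ℤ.* ((+ 2 ℤ.* (H ℤ.+ H)) ℤ.* (H ℤ.+ H))
      identity = solve-∀

  exponentW′-shift : ∀ b b′ l l′ D → Σ ℤ λ t →
    exponentW′ (+ toℕ (shiftIf b l)) (+ toℕ (shiftIf b′ l′)) D ≡
    exponentW′ (+ toℕ l) (+ toℕ l′) D ℤ.+ + h ℤ.* ((bit b ℤ.- bit b′) ℤ.* D) ℤ.+ t ℤ.* + m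
  exponentW′-shift b b′ l l′ D with toℤ-shiftIf b l | toℤ-shiftIf b′ l′
  ... | k , l₁≡ | k′ , l₁′≡ = (k ℤ.- k′) ℤ.* D ,
    shifted {+ m} {+ h} {+ toℕ l} {+ toℕ l′} {x = bit b} {bit b′} {k} {k′} (≡.cong +_ (≡.sym h+h≡m)) l₁≡ l₁′≡
    where
    shifted : ∀ {M H L L′ L₁ L₁′ x y cx cy : ℤ} → M ≡ H ℤ.+ H →
      L₁ ≡ L ℤ.+ H ℤ.* x ℤ.+ cx ℤ.* M → L₁′ ≡ L′ ℤ.+ H ℤ.* y ℤ.+ cy ℤ.* M →
      (L₁ ℤ.- L₁′) ℤ.* D ≡ (L ℤ.- L′) ℤ.* D ℤ.+ H ℤ.* ((x ℤ.- y) ℤ.* D) ℤ.+ ((cx ℤ.- cy) ℤ.* D) ℤ.* M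
    shifted {H = H} {L} {L′} {x = x} {y} {cx} {cy} ≡.refl ≡.refl ≡.refl = identity H L L′ x y cx cy D
      where
      identity : ∀ H L L′ x y cx cy D →
        ((L ℤ.+ H ℤ.* x ℤ.+ cx ℤ.* (H ℤ.+ H)) ℤ.- (L′ ℤ.+ H ℤ.* y ℤ.+ cy ℤ.* (H ℤ.+ H))) ℤ.* D ≡
        (L ℤ.- L′) ℤ.* D ℤ.+ H ℤ.* ((x ℤ.- y) ℤ.* D) ℤ.+ ((cx ℤ.- cy) ℤ.* D) ℤ.* (H ℤ.+ H)
      identity = solve-∀

module Equivalence {c ℓ : Level} (F : CommutativeRing c ℓ) (m h : ℕ) .{{_ : NonZero m}} (h+h≡m : h ℕ.+ h ≡ m)
                   (r : ℕ) (u uinv : CommutativeRing.Carrier F) (H₁ H₂ : Fin r → Fin r → ℤ)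
                   (π ρ : Fin r ↔ Fin r) (d e : Fin r → ℤ) (d±1 : ∀ x → IsSign (d x)) (e±1 : ∀ y → IsSign (e y))
                   (H₂≡ : ∀ x y → H₂ x y ≡ d x ℤ.* e y ℤ.* H₁ (Inverse.to π x) (Inverse.to ρ y)) where
  open CommutativeRing F
  open Exponentiation F
  open HalfShift m h h+h≡m
  open import Algebra.Properties.CommutativeSemigroup *-commutativeSemigroup using (xy∙z≈xz∙y)
  open import Relation.Binary.Reasoning.Setoid setoid

  Au-permute : ∀ {f : Fin r → Fin r} → Injective _≡_ _≡_ f → ∀ x y → Au F r u uinv (f x) (f y) ≡ Au F r u uinv x y
  Au-permute {f} f-injective x y with x ≟ y | f x ≟ f y
  ... | yes _   | yes _     = ≡.refl
  ... | no _    | no _      = ≡.refl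
  ... | yes x≡y | no fx≢fy  = ⊥-elim (fx≢fy (≡.cong f x≡y))
  ... | no x≢y  | yes fx≡fy = ⊥-elim (x≢y (f-injective fx≡fy))

  rowFlip colFlip : Fin r → Bool
  rowFlip x = isNegative (d x) (d±1 x)
  colFlip y = isNegative (e y) (e±1 y)

  H-signs : ∀ x y → fromℤ F (H₂ x y) ≈
            (-1^ bit (rowFlip x) * -1^ bit (colFlip y)) * fromℤ F (H₁ (Inverse.to π x) (Inverse.to ρ y))
  H-signs x y = begin
    fromℤ F (H₂ x y)                        ≡⟨ ≡.cong (fromℤ F) H₂≡signs ⟩
    fromℤ F (signℤ p ℤ.* signℤ q ℤ.* H)    ≡⟨ ≡.cong (fromℤ F) (ℤₚ.*-assoc (signℤ p) (signℤ q) H) ⟩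
    fromℤ F (signℤ p ℤ.* (signℤ q ℤ.* H))  ≈⟨ fromℤ-signℤ p (signℤ q ℤ.* H) ⟩
    -1^ bit p * fromℤ F (signℤ q ℤ.* H)     ≈⟨ *-congˡ (fromℤ-signℤ q H) ⟩
    -1^ bit p * (-1^ bit q * fromℤ F H)     ≈⟨ *-assoc _ _ _ ⟨
    (-1^ bit p * -1^ bit q) * fromℤ F H     ∎
    where
    p q : Bool
    p = rowFlip x
    q = colFlip y
    H : ℤ
    H = H₁ (Inverse.to π x) (Inverse.to ρ y)
    H₂≡signs : H₂ x y ≡ signℤ p ℤ.* signℤ q ℤ.* H
    H₂≡signs = ≡.trans (H₂≡ x y)
      (≡.cong₂ (λ s t → s ℤ.* t ℤ.* H) (IsSign⇒≡signℤ (d x) (d±1 x)) (IsSign⇒≡signℤ (e y) (e±1 y)))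

  permuteAt unpermuteAt : Fin m → Fin r → Fin r
  permuteAt   i = onParity (toℕ i ℕ.% 2) (Inverse.to π) (Inverse.to ρ)
  unpermuteAt i = onParity (toℕ i ℕ.% 2) (Inverse.from π) (Inverse.from ρ)

  flipAt : Fin m → Fin r → Bool
  flipAt i x = onParity (toℕ i ℕ.% 2) (rowFlip x) (colFlip x)

  σ-to σ-from : X F m r → X F m r
  σ-to   (i , l , x) = i , shiftIf (flipAt i x) l , permuteAt i x
  σ-from (i , l , x) = i , shiftIf (flipAt i (unpermuteAt i x)) l , unpermuteAt i x

  σ : X F m r ↔ X F m r
  σ = mk↔ₛ′ σ-to σ-from to∘from from∘to
    where
    to∘from : ∀ α → σ-to (σ-from α) ≡ α
    to∘from (i , l , x) = ≡.cong₂ (λ l′ x′ → i , l′ , x′) (shiftIf-involutive (flipAt i (unpermuteAt i x)) l)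
      (onParity-inverse (toℕ i ℕ.% 2) (Inverse.strictlyInverseˡ π) (Inverse.strictlyInverseˡ ρ) x)
    from∘to : ∀ α → σ-from (σ-to α) ≡ α
    from∘to (i , l , x) =
      unshift _ (onParity-inverse (toℕ i ℕ.% 2) (Inverse.strictlyInverseʳ π) (Inverse.strictlyInverseʳ ρ) x)
      where
      unshift : ∀ x′ → x′ ≡ x → (i , shiftIf (flipAt i x′) (shiftIf (flipAt i x) l) , x′) ≡ (i , l , x)
      unshift _ ≡.refl = ≡.cong (λ l′ → i , l′ , x) (shiftIf-involutive (flipAt i x) l)

  twistExponent : Fin m → Fin m → Fin r → Fin r → ℤ
  twistExponent i j x y = (bit (flipAt i x) ℤ.- bit (flipAt j y)) ℤ.* dif F i j

  V-twist : ∀ i j x y → V F m r H₂ u uinv i j x y ≈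
            -1^ twistExponent i j x y * V F m r H₁ u uinv i j (permuteAt i x) (permuteAt j y)
  V-twist i j x y with toℕ i ℕ.% 2 | parity (toℕ i) | toℕ j ℕ.% 2 | parity (toℕ j)
  ... | .0 | even a i≡ | .0 | even b j≡ = sym (trans
    (*-congʳ (-1^-even (same-parity-exponent (+ 0) a b (bit (rowFlip x)) (bit (rowFlip y)) i≡ j≡)))
    (trans (*-identityˡ _) (reflexive (Au-permute (Injection.injective (↔⇒↣ π)) x y))))
  ... | .1 | odd a i≡  | .1 | odd b j≡  = sym (trans
    (*-congʳ (-1^-even (same-parity-exponent (+ 1) a b (bit (colFlip x)) (bit (colFlip y)) i≡ j≡)))
    (trans (*-identityˡ _) (reflexive (Au-permute (Injection.injective (↔⇒↣ ρ)) x y))))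
  ... | .0 | even a i≡ | .1 | odd b j≡  = trans (H-signs x y) (*-congʳ (sym
    (-1^-odd (bit (rowFlip x)) (bit (colFlip y)) (even-odd-exponent a b (bit (rowFlip x)) (bit (colFlip y)) i≡ j≡))))
  ... | .1 | odd a i≡  | .0 | even b j≡ = trans (H-signs y x) (*-congʳ (sym
    (-1^-odd (bit (rowFlip y)) (bit (colFlip x)) (odd-even-exponent a b (bit (colFlip x)) (bit (rowFlip y)) i≡ j≡))))

  twisted-entry : ∀ {w₁ w ε v₁ v₂} → w₁ ≈ w * ε → v₂ ≈ ε * v₁ → 1# * (w₁ * v₁) ≈ w * v₂
  twisted-entry {w₁} {w} {ε} {v₁} {v₂} w₁≈wε v₂≈εv₁ = begin
    1# * (w₁ * v₁)  ≈⟨ *-identityˡ _ ⟩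
    w₁ * v₁         ≈⟨ *-congʳ w₁≈wε ⟩
    (w * ε) * v₁    ≈⟨ *-assoc w ε v₁ ⟩
    w * (ε * v₁)    ≈⟨ *-congˡ v₂≈εv₁ ⟨
    w * v₂          ∎

  W-σ : ∀ a → pow F a (m ℕ.* m) ≈ - 1# → ∀ α β →
        1# * W F m r H₁ u uinv a (σ-to α) (σ-to β) ≈ W F m r H₂ u uinv a α β
  W-σ a a^mm≈-1 (i , l , x) (j , l′ , y) = twisted-entry
    (rpow-half-shift (exponentW (+ toℕ l) (+ toℕ l′) (dif F i j)) (twistExponent i j x y)
      (exponentW-shift (flipAt i x) (flipAt j y) l l′ (dif F i j)))
    (V-twist i j x y)
    where
    open HalfPeriod a (2 ℕ.* m ℕ.* m) (m ℕ.* m) {{ℕₚ.m*n≢0 (2 ℕ.* m) m {{ℕₚ.m*n≢0 2 m}}}}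
                    (m*m+m*m≡2*m*m m) a^mm≈-1

  W′-σ : ∀ η → pow F η h ≈ - 1# → ∀ b α β →
         1# * W' F m r H₁ u uinv η b (σ-to α) (σ-to β) ≈ W' F m r H₂ u uinv η b α β
  W′-σ η η^h≈-1 b (i , l , x) (j , l′ , y) = twisted-entry
    (trans (*-congʳ (rpow-half-shift (exponentW′ (+ toℕ l) (+ toℕ l′) (dif F i j)) (twistExponent i j x y)
              (exponentW′-shift (flipAt i x) (flipAt j y) l l′ (dif F i j))))
           (xy∙z≈xz∙y _ _ _))
    (V-twist i j x y)
    where open HalfPeriod η m h h+h≡m η^h≈-1

lemma4p5 : {c ℓ : Level} (F : CommutativeRing c ℓ) → IsField F →
    let open CommutativeRing F in
    (m : ℕ) → .{{_ : NonZero m}} → 2 ∣ m →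
    (r : ℕ) → 0 < r →
    (u uinv : Carrier) → u * uinv ≈ 1# →
    (r ≥ 2 → pow F (pow F u 2 + pow F uinv 2) 2 ≈ fromℕ F r) →
    (r ≡ 1 → pow F u 4 ≈ 1#) →
    (η : Carrier) → IsPrimitiveRoot F m η →
    (a : Carrier) → IsPrimitiveRoot F (2 ℕ.* m ℕ.* m) a →
    (b : Carrier) → IsRootOfUnity F (m ℕ.* m) b →
    (H₁ H₂ : Fin r → Fin r → ℤ) → IsHadamard r H₁ → IsHadamard r H₂ →
    HadEquiv r H₁ H₂ →
    MatEquiv F m r (W F m r H₁ u uinv a) (W F m r H₂ u uinv a) ×
    MatEquiv F m r (W' F m r H₁ u uinv η b) (W' F m r H₂ u uinv η b)
lemma4p5 F isField m (divides h m≡h*2) r _ u uinv _ _ _ η η-primitive a a-primitive b _ H₁ H₂ _ _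
         (π , ρ , d , e , d±1 , e±1 , H₂≡) =
  (σ , 1# , pow-1# 4 , W-σ a (primitive-root^half≈-1 isField (m ℕ.* m) a-primitive (m*m+m*m≡2*m*m m) 0<mm)) ,
  (σ , 1# , pow-1# 4 , W′-σ η (primitive-root^half≈-1 isField h η-primitive h+h≡m (n+n≡m⇒0<n h+h≡m)) b)
  where
  open CommutativeRing F using (1#)
  open Exponentiation F using (pow-1#; primitive-root^half≈-1)
  h+h≡m : h ℕ.+ h ≡ m
  h+h≡m = ≡.trans (identity h) (≡.sym m≡h*2)
    where
    identity : ∀ h → h ℕ.+ h ≡ h ℕ.* 2
    identity = ℕ-Solver.solve-∀
  0<mm : 0 < m ℕ.* m
  0<mm = ℕ.>-nonZero⁻¹ (m ℕ.* m) {{ℕₚ.m*n≢0 m m}}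
  open Equivalence F m h h+h≡m r u uinv H₁ H₂ π ρ d e d±1 e±1 H₂≡
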